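{- For all $\alpha\in\mathbb{N}=\{1,2,\dots\}$ and every $n\in\mathbb{N}$, the number of rational Schröder paths with slope $\alpha$ from $(0,0)$ to $(n,\alpha n)$ equals the cardinality of $\mathfrak{D}^{\pmb{\sigma}}_n(\alpha-1,1)$: \[\#\mathcal{S}_n(\alpha)=\#\mathfrak{D}^{\pmb{\sigma}}_n(\alpha-1,1).\]
   Context: $\mathcal{S}_n(\alpha)$ is the set of lattice paths from $(0,0)$ to $(n,\alpha n)$ with steps $\mathsf{E}=(1,0)$, $\mathsf{N}=(0,1)$, $\mathsf{D}=(1,1)$ staying weakly above the line $y=\alpha x$. For an integer $a\ge 0$ and a sequence $\mathbf{c}=(c_1,c_2,\dots)$ of nonnegative integers, $\mathfrak{D}^{\mathbf{c}}_n(a,1)$ is the set of colored Dyck paths obtained as follows: Dyck paths (words in $u,d$) of semilength $(a+1)n$ that are concatenations of strings $d$ and $u^{(a+1)j}d^{j}$ ($j=1,\dots,n$) — equivalently, every maximal run of up-steps has length $(a+1)j$ for some $j\ge1$ and is immediately followed by at least $j$ down-steps — where each maximal ascent $u^{(a+1)j}$ is assigned one of $c_j$ colors (two such paths are the same only if the underlying path and all colors agree). The sequence $\pmb{\sigma}=(\sigma_1,\sigma_2,\dots)$ is given by $\sigma_j=2s_{j-1}$, where $s_m$ is the little Schröder number: the number of lattice paths from $(0,0)$ to $(m,m)$ with steps $\mathsf{E},\mathsf{N},\mathsf{D}$ staying weakly above $y=x$ with no $\mathsf{D}$-step on $y=x$. Equivalently, $\sigma_j$ is the number of Schröder paths from $(0,0)$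 to $(j,j)$ lying strictly above $y=x$ except at their endpoints, together with (for $j=1$) the path $\mathsf{D}$; so $\sigma_1=2$ and $\sigma_2,\sigma_3,\dots=2,6,22,90,\dots$ are the large Schröder numbers. -}

module Defs where

open import Data.Nat using (ℕ; zero; suc; _+_; _*_; _∸_; _≤ᵇ_; _≡ᵇ_)
open import Data.Bool using (Bool; true; false; _∧_; not; T)
open import Data.List using (List; []; _∷_; length; map; concatMap; filter; upTo)
open import Data.Nat.ListAction using (sum)
open import Data.List.Relation.Unary.All using (All)
open import Data.Product using (Σ; _×_; _,_; proj₁)
open import Data.Fin using (Fin)
open import Data.Nat.DivMod using (_/_)
open import Relation.Nullary.Decidable using (Dec; yes; no)
open import Data.Bool.Properties using (T?)

data Step : Set where
  E N D : Step

move : ℕ × ℕ → Step → ℕ × ℕ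
move (x , y) E = (suc x , y)
move (x , y) N = (x , suc y)
move (x , y) D = (suc x , suc y)

endpoint : ℕ × ℕ → List Step → ℕ × ℕ
endpoint p []      = p
endpoint p (s ∷ w) = endpoint (move p s) w

eqPt : ℕ × ℕ → ℕ × ℕ → Bool
eqPt (x , y) (x' , y') = (x ≡ᵇ x') ∧ (y ≡ᵇ y')

aboveSlope : ℕ → ℕ × ℕ → List Step → Bool
aboveSlope α (x , y) []      = (α * x) ≤ᵇ y
aboveSlope α (x , y) (s ∷ w) = ((α * x) ≤ᵇ y) ∧ aboveSlope α (move (x , y) s) w

isRatSchroeder : ℕ → ℕ → List Step → Bool
isRatSchroeder α n w = eqPt (endpoint (0 , 0) w) (n , α * n) ∧ aboveSlope α (0 , 0) w

-- S_n(α) as a type (T of a Bool is proof-irrelevant, so this is a set of words)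
SchroederPath : ℕ → ℕ → Set
SchroederPath α n = Σ (List Step) (λ w → T (isRatSchroeder α n w))

noDiagD : ℕ × ℕ → List Step → Bool
noDiagD p []            = true
noDiagD (x , y) (E ∷ w) = noDiagD (suc x , y) w
noDiagD (x , y) (N ∷ w) = noDiagD (x , suc y) w
noDiagD (x , y) (D ∷ w) = not (x ≡ᵇ y) ∧ noDiagD (suc x , suc y) w

isLittleSchroeder : ℕ → List Step → Bool
isLittleSchroeder m w =
  eqPt (endpoint (0 , 0) w) (m , m) ∧ aboveSlope 1 (0 , 0) w ∧ noDiagD (0 , 0) w

words : ℕ → List (List Step)
words zero    = [] ∷ []
words (suc k) = concatMap (λ w → (E ∷ w) ∷ (N ∷ w) ∷ (D ∷ w) ∷ []) (words k)

-- a path to (m,m) has between m and 2m steps, so lengths 0..2m suffice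
littleSchroeder : ℕ → ℕ
littleSchroeder m =
  sum (map (λ k → length (filter (λ w → T? (isLittleSchroeder m w)) (words k)))
           (upTo (suc (2 * m))))

-- σ_j = 2 s_{j-1} for j ≥ 1 (σ_0 is never used)
σ : ℕ → ℕ
σ zero    = 0
σ (suc j) = 2 * littleSchroeder j

data UD : Set where
  u d : UD

dyckFrom : ℕ → List UD → Bool
dyckFrom h []           = h ≡ᵇ 0
dyckFrom h (u ∷ w)      = dyckFrom (suc h) w
dyckFrom zero (d ∷ w)   = false
dyckFrom (suc h) (d ∷ w) = dyckFrom h w

isDyck : List UD → Bool
isDyck = dyckFrom 0

-- for each maximal run of u's (a maximal ascent), in order:
-- (its length, number of d's immediately following it)
mutual
  inU : ℕ → List UD → List (ℕ × ℕ)
  inU k []      = (k , 0) ∷ []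
  inU k (u ∷ w) = inU (suc k) w
  inU k (d ∷ w) = inD k 1 w

  inD : ℕ → ℕ → List UD → List (ℕ × ℕ)
  inD k m []      = (k , m) ∷ []
  inD k m (d ∷ w) = inD k (suc m) w
  inD k m (u ∷ w) = (k , m) ∷ inU 1 w

ascentData : List UD → List (ℕ × ℕ)
ascentData []      = []
ascentData (d ∷ w) = ascentData w
ascentData (u ∷ w) = inU 1 w

-- a maximal ascent of length k followed by m down-steps is admissible iff
-- k = (a+1) j for some j ≥ 1 and m ≥ j
okAscent : ℕ → ℕ × ℕ → Bool
okAscent a (k , m) =
  (1 ≤ᵇ k / suc a) ∧ ((k / suc a) * suc a ≡ᵇ k) ∧ ((k / suc a) ≤ᵇ m)

allB : {A : Set} → (A → Bool) → List A → Bool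
allB p []      = true
allB p (x ∷ xs) = p x ∧ allB p xs

isADyck : ℕ → ℕ → List UD → Bool
isADyck a n w =
  isDyck w ∧ (length w ≡ᵇ 2 * (suc a * n)) ∧ allB (okAscent a) (ascentData w)

-- 𝔇^c_n(a,1): an admissible Dyck word of semilength (a+1)n together with,
-- for each maximal ascent u^{(a+1)j} (in order), one of c_j colors
ColoredDyck : ℕ → (ℕ → ℕ) → ℕ → Set
ColoredDyck a c n =
  Σ (List UD) (λ w → T (isADyck a n w) ×
                      All (λ km → Fin (c (proj₁ km / suc a))) (ascentData w))

private
  open import Relation.Binary.PropositionalEquality using (_≡_; refl)
  _ : littleSchroeder 0 ≡ 1
  _ = refl
  _ : littleSchroeder 1 ≡ 1
  _ = refl
  _ : littleSchroeder 2 ≡ 3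
  _ = refl
  _ : littleSchroeder 3 ≡ 11
  _ = refl

module Submission where

open import Defs
open import Level using (0ℓ)
open import Data.Nat using (ℕ; zero; suc; _+_; _*_; _∸_; _≤_; _<_; z≤n; s≤s; _≤ᵇ_; _≡ᵇ_; _/_; pred)
open import Data.Nat.Properties
open import Data.Nat.DivMod using (m*n/n≡m)
open import Data.Nat.ListAction using (sum)
open import Data.Nat.Tactic.RingSolver using (solve-∀)
open import Algebra.Properties.CommutativeSemigroup +-commutativeSemigroup using (x∙yz≈y∙xz)
open import Data.Bool using (Bool; true; false; _∧_; not; T)
open import Data.Bool.Properties using (T-irrelevant; ∧-assoc; T?)
open import Data.Unit using (⊤; tt)
open import Data.Empty using (⊥; ⊥-elim)
open import Data.Sum using (_⊎_; inj₁; inj₂)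
open import Data.Sum.Algebra using (⊎-assoc)
open import Data.Sum.Function.Propositional using (_⊎-↔_)
open import Data.Product using (Σ; _×_; _,_; proj₁; proj₂; map₁)
open import Data.Product.Algebra using (Σ-assoc)
open import Data.Product.Function.NonDependent.Propositional using (_×-↔_)
open import Data.Product.Function.Dependent.Propositional using (Σ-↔)
open import Data.Maybe using (Maybe; just; nothing) renaming (map to mapMaybe)
open import Data.List using (List; []; _∷_; _++_; length; map; [_]; replicate; filter; lookup; applyUpTo; concatMap)
open import Data.List.Properties using (++-assoc; length-++; length-replicate)
open import Data.List.Relation.Unary.All using (All; []; _∷_)
open import Data.Fin using (Fin; zero; suc; toℕ; fromℕ<)
open import Data.Fin.Properties using (toℕ-injective; toℕ-fromℕ<; +↔⊎; *↔×)
open import Function.Base using (_∘_; id)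
open import Function.Bundles using (_↔_; mk↔ₛ′; _⇔_; mk⇔; Equivalence)
open import Function.Properties.Inverse using (↔-refl; ↔-sym; ↔-trans)
open import Relation.Binary.PropositionalEquality hiding ([_])
open import Relation.Nullary using (¬_)

∧-fst : ∀ b {c} → T (b ∧ c) → T b
∧-fst true _ = tt

∧-snd : ∀ b {c} → T (b ∧ c) → T c
∧-snd true p = p

∧-intro : ∀ {b c} → T b → T c → T (b ∧ c)
∧-intro {true} _ q = q

T⇒≡true : ∀ {b} → T b → b ≡ true
T⇒≡true {true} _ = refl

¬T⇒≡false : ∀ {b} → ¬ T b → b ≡ false
¬T⇒≡false {true}  n = ⊥-elim (n tt)
¬T⇒≡false {false} _ = refl

∧-trueˡ : ∀ {b} c → T b → (b ∧ c) ≡ c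
∧-trueˡ {true} c _ = refl

∧-falseˡ : ∀ {b} c → ¬ T b → (b ∧ c) ≡ false
∧-falseˡ {b} c nb rewrite ¬T⇒≡false nb = refl

subset-↔ : ∀ {A B : Set} {P : A → Set} {Q : B → Set} →
  (∀ x (p q : P x) → p ≡ q) → (∀ y (p q : Q y) → p ≡ q) →
  (f : A → B) (g : B → A) →
  (∀ x → P x → Q (f x)) → (∀ y → Q y → P (g y)) →
  (∀ x → P x → g (f x) ≡ x) → (∀ y → Q y → f (g y) ≡ y) →
  Σ A P ↔ Σ B Q
subset-↔ {A} {B} {P} {Q} irrP irrQ f g fP gQ gf fg =
  mk↔ₛ′ (λ (x , p) → f x , fP x p) (λ (y , q) → g y , gQ y q)
        (λ (y , q) → pair-≡ irrQ (fg y q)) (λ (x , p) → pair-≡ irrP (gf x p))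
  where
    pair-≡ : ∀ {C : Set} {R : C → Set} → (∀ z (r s : R z) → r ≡ s) →
             ∀ {z z'} {r : R z} {s : R z'} → z ≡ z' → _≡_ {A = Σ C R} (z , r) (z' , s)
    pair-≡ irr {z} {r = r} {s} refl = cong (z ,_) (irr z r s)

T×≡-irrelevant : ∀ b m n (p q : T b × m ≡ n) → p ≡ q
T×≡-irrelevant b m n (p , e) (q , e') = cong₂ _,_ (T-irrelevant p q) (≡-irrelevant e e')

Δx : List Step → ℕ
Δx []      = 0
Δx (E ∷ w) = suc (Δx w)
Δx (N ∷ w) = Δx w
Δx (D ∷ w) = suc (Δx w)

Δy : List Step → ℕ
Δy []      = 0
Δy (E ∷ w) = Δy w
Δy (N ∷ w) = suc (Δy w)
Δy (D ∷ w) = suc (Δy w)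

Δx-++ : ∀ w v → Δx (w ++ v) ≡ Δx w + Δx v
Δx-++ []      v = refl
Δx-++ (E ∷ w) v = cong suc (Δx-++ w v)
Δx-++ (N ∷ w) v = Δx-++ w v
Δx-++ (D ∷ w) v = cong suc (Δx-++ w v)

Δy-++ : ∀ w v → Δy (w ++ v) ≡ Δy w + Δy v
Δy-++ []      v = refl
Δy-++ (E ∷ w) v = Δy-++ w v
Δy-++ (N ∷ w) v = cong suc (Δy-++ w v)
Δy-++ (D ∷ w) v = cong suc (Δy-++ w v)

endpoint-Δ : ∀ x y w → endpoint (x , y) w ≡ (x + Δx w , y + Δy w)
endpoint-Δ x y []      = cong₂ _,_ (sym (+-identityʳ x)) (sym (+-identityʳ y))
endpoint-Δ x y (E ∷ w) = trans (endpoint-Δ (suc x) y w) (cong (_, y + Δy w) (sym (+-suc x (Δx w))))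
endpoint-Δ x y (N ∷ w) = trans (endpoint-Δ x (suc y) w) (cong (x + Δx w ,_) (sym (+-suc y (Δy w))))
endpoint-Δ x y (D ∷ w) = trans (endpoint-Δ (suc x) (suc y) w)
                               (cong₂ _,_ (sym (+-suc x (Δx w))) (sym (+-suc y (Δy w))))

eqPt⇒≡ : ∀ p q → T (eqPt p q) → p ≡ q
eqPt⇒≡ (x , y) (x' , y') t = cong₂ _,_ (≡ᵇ⇒≡ x x' (∧-fst (x ≡ᵇ x') t)) (≡ᵇ⇒≡ y y' (∧-snd (x ≡ᵇ x') t))

≡⇒eqPt : ∀ p q → p ≡ q → T (eqPt p q)
≡⇒eqPt (x , y) _ refl = ∧-intro (≡⇒≡ᵇ x x refl) (≡⇒≡ᵇ y y refl)

-- The dual of a path traverses it backwards with E and N exchanged, i.e. it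
-- is the image under a point reflection followed by the reflection in y = x.
flip : Step → Step
flip E = N
flip N = E
flip D = D

dual : List Step → List Step
dual []      = []
dual (s ∷ w) = dual w ++ [ flip s ]

dual-snoc : ∀ w s → dual (w ++ [ s ]) ≡ flip s ∷ dual w
dual-snoc []      s = refl
dual-snoc (t ∷ w) s = cong (_++ [ flip t ]) (dual-snoc w s)

flip-involutive : ∀ s → flip (flip s) ≡ s
flip-involutive E = refl
flip-involutive N = refl
flip-involutive D = refl

dual-involutive : ∀ w → dual (dual w) ≡ w
dual-involutive []      = refl
dual-involutive (s ∷ w) = trans (dual-snoc (dual w) (flip s))
                                (cong₂ _∷_ (flip-involutive s) (dual-involutive w))

Δy-dual : ∀ w → Δy (dual w) ≡ Δx w
Δy-dual []      = refl
Δy-dual (E ∷ w) = trans (Δy-++ (dual w) [ N ]) (trans (+-comm _ 1) (cong suc (Δy-dual w)))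
Δy-dual (N ∷ w) = trans (Δy-++ (dual w) [ E ]) (trans (+-identityʳ _) (Δy-dual w))
Δy-dual (D ∷ w) = trans (Δy-++ (dual w) [ D ]) (trans (+-comm _ 1) (cong suc (Δy-dual w)))

-- lower m h k is k (h ∸ m) when m ≤ h and false otherwise: the test to apply
-- after a height h has been lowered by m without going negative.
lower : ℕ → ℕ → (ℕ → Bool) → Bool
lower zero    h       k = k h
lower (suc m) zero    k = false
lower (suc m) (suc h) k = lower m h k

lower-cong : ∀ m h {k k' : ℕ → Bool} → (∀ g → k g ≡ k' g) → lower m h k ≡ lower m h k'
lower-cong zero    h       eq = eq h
lower-cong (suc m) zero    eq = refl
lower-cong (suc m) (suc h) eq = lower-cong m h eq

lower-false : ∀ m h → false ≡ lower m h (λ _ → false)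
lower-false zero    h       = refl
lower-false (suc m) zero    = refl
lower-false (suc m) (suc h) = lower-false m h

lower-≡ᵇ : ∀ m g h → (m + g ≡ᵇ h) ≡ lower m h (g ≡ᵇ_)
lower-≡ᵇ zero    g h       = refl
lower-≡ᵇ (suc m) g zero    = refl
lower-≡ᵇ (suc m) g (suc h) = lower-≡ᵇ m g h

lower-inv : ∀ m h k → T (lower m h k) → Σ ℕ (λ h₁ → h ≡ m + h₁ × T (k h₁))
lower-inv zero    h       k t = h , refl , t
lower-inv (suc m) (suc h) k t with lower-inv m h k t
... | h₁ , e , t' = h₁ , cong suc e , t'

lower-intro : ∀ m h₁ k → T (k h₁) → T (lower m (m + h₁) k)
lower-intro zero    h₁ k t = t
lower-intro (suc m) h₁ k t = lower-intro m h₁ k t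

-- Fix α = a + 1.  The slack of a point (x, y) is y − α x: a path stays weakly
-- above y = α x iff its slack never goes negative.  The dual path is followed
-- through the same numbers backwards, an N of the dual raising them by α,
-- a D by a and an E lowering them by 1.
module Slack (a : ℕ) where
  α : ℕ
  α = suc a

  slackWalk : ℕ → List Step → ℕ → Bool
  slackWalk h []      h' = h' ≡ᵇ h
  slackWalk h (N ∷ w) h' = slackWalk (suc h) w h'
  slackWalk h (E ∷ w) h' = lower α h (λ h₁ → slackWalk h₁ w h')
  slackWalk h (D ∷ w) h' = lower a h (λ h₁ → slackWalk h₁ w h')

  slackStays : ℕ → List Step → Bool
  slackStays h []      = true
  slackStays h (N ∷ w) = slackStays (suc h) w
  slackStays h (E ∷ w) = lower α h (λ h₁ → slackStays h₁ w)
  slackStays h (D ∷ w) = lower a h (λ h₁ → slackStays h₁ w)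

  dualWalk : ℕ → List Step → ℕ → Bool
  dualWalk g []      h = g ≡ᵇ h
  dualWalk g (N ∷ v) h = dualWalk (α + g) v h
  dualWalk g (D ∷ v) h = dualWalk (a + g) v h
  dualWalk g (E ∷ v) h = lower 1 g (λ g₁ → dualWalk g₁ v h)

  dualWalk-snocE : ∀ v g h → dualWalk g (v ++ [ E ]) h ≡ dualWalk g v (suc h)
  dualWalk-snocE []      zero    h = refl
  dualWalk-snocE []      (suc g) h = refl
  dualWalk-snocE (N ∷ v) g       h = dualWalk-snocE v (α + g) h
  dualWalk-snocE (D ∷ v) g       h = dualWalk-snocE v (a + g) h
  dualWalk-snocE (E ∷ v) zero    h = refl
  dualWalk-snocE (E ∷ v) (suc g) h = dualWalk-snocE v g h

  dualWalk-snocRise : ∀ m s → (∀ g h → dualWalk g [ s ] h ≡ (m + g ≡ᵇ h)) →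
    ∀ v g h → dualWalk g (v ++ [ s ]) h ≡ lower m h (dualWalk g v)
  dualWalk-snocRise m s last []      g       h = trans (last g h) (lower-≡ᵇ m g h)
  dualWalk-snocRise m s last (N ∷ v) g       h = dualWalk-snocRise m s last v (α + g) h
  dualWalk-snocRise m s last (D ∷ v) g       h = dualWalk-snocRise m s last v (a + g) h
  dualWalk-snocRise m s last (E ∷ v) zero    h = lower-false m h
  dualWalk-snocRise m s last (E ∷ v) (suc g) h = dualWalk-snocRise m s last v g h

  slackWalk≡dualWalk : ∀ w h h' → slackWalk h w h' ≡ dualWalk h' (dual w) h
  slackWalk≡dualWalk []      h h' = refl
  slackWalk≡dualWalk (N ∷ w) h h' =
    trans (slackWalk≡dualWalk w (suc h) h') (sym (dualWalk-snocE (dual w) h' h))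
  slackWalk≡dualWalk (E ∷ w) h h' =
    trans (lower-cong α h (λ h₁ → slackWalk≡dualWalk w h₁ h'))
          (sym (dualWalk-snocRise α N (λ _ _ → refl) (dual w) h' h))
  slackWalk≡dualWalk (D ∷ w) h h' =
    trans (lower-cong a h (λ h₁ → slackWalk≡dualWalk w h₁ h'))
          (sym (dualWalk-snocRise a D (λ _ _ → refl) (dual w) h' h))

  aboveSlope-below : ∀ w x y → y < α * x → aboveSlope α (x , y) w ≡ false
  aboveSlope-below []      x y lt = ¬T⇒≡false (λ t → <⇒≱ lt (≤ᵇ⇒≤ (α * x) y t))
  aboveSlope-below (s ∷ w) x y lt = ∧-falseˡ _ (λ t → <⇒≱ lt (≤ᵇ⇒≤ (α * x) y t))

  mutual
    aboveSlope≡slackStays : ∀ w h x y → y ≡ h + α * x → aboveSlope α (x , y) w ≡ slackStays h w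
    aboveSlope≡slackStays []      h x y eq = T⇒≡true (onOrAbove h x y eq)
    aboveSlope≡slackStays (N ∷ w) h x y eq = trans (∧-trueˡ _ (onOrAbove h x y eq))
      (aboveSlope≡slackStays w (suc h) x (suc y) (cong suc eq))
    aboveSlope≡slackStays (E ∷ w) h x y eq = trans (∧-trueˡ _ (onOrAbove h x y eq))
      (aboveSlope≡lower α h (α * x) w (suc x) y (*-suc α x) eq)
    aboveSlope≡slackStays (D ∷ w) h x y eq = trans (∧-trueˡ _ (onOrAbove h x y eq))
      (aboveSlope≡lower a h (suc (α * x)) w (suc x) (suc y)
        (trans (*-suc α x) (sym (+-suc a (α * x)))) (trans (cong suc eq) (sym (+-suc h (α * x)))))

    aboveSlope≡lower : ∀ m h t w x y → α * x ≡ m + t → y ≡ h + t →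
      aboveSlope α (x , y) w ≡ lower m h (λ h₁ → slackStays h₁ w)
    aboveSlope≡lower zero    h       t w x y e₁ e₂ =
      aboveSlope≡slackStays w h x y (trans e₂ (cong (h +_) (sym e₁)))
    aboveSlope≡lower (suc m) zero    t w x y e₁ e₂ =
      aboveSlope-below w x y (subst (y <_) (sym e₁) (subst (_< suc m + t) (sym e₂) (s≤s (m≤n+m t m))))
    aboveSlope≡lower (suc m) (suc h) t w x y e₁ e₂ =
      aboveSlope≡lower m h (suc t) w x y (trans e₁ (sym (+-suc m t))) (trans e₂ (sym (+-suc h t)))

    private
      onOrAbove : ∀ h x y → y ≡ h + α * x → T (α * x ≤ᵇ y)
      onOrAbove h x y eq = ≤⇒≤ᵇ (subst (α * x ≤_) (sym eq) (m≤n+m (α * x) h))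

  -- Balance of the endpoint: h + Δy w = h' + α Δx w.  Prefixing an E-step or
  -- a D-step to w adds the same amount to both sides of the balance.
  private
    shift : ∀ k {h₁ c h' r} → h₁ + c ≡ h' + r → (k + h₁) + c ≡ h' + (k + r)
    shift k {h₁} {c} {h'} {r} e =
      trans (+-assoc k h₁ c) (trans (cong (k +_) e) (x∙yz≈y∙xz k h' r))

    unshift : ∀ k {h₁ c h' r} → (k + h₁) + c ≡ h' + (k + r) → h₁ + c ≡ h' + r
    unshift k {h₁} {c} {h'} {r} e =
      +-cancelˡ-≡ k _ _ (trans (sym (+-assoc k h₁ c)) (trans e (x∙yz≈y∙xz h' k r)))

    balanceE : ∀ h₁ c h' r → ((α + h₁) + c ≡ h' + α * suc r) ⇔ (h₁ + c ≡ h' + α * r)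
    balanceE h₁ c h' r = mk⇔
      (λ e → unshift α (trans e (cong (h' +_) (*-suc α r))))
      (λ e → trans (shift α e) (cong (h' +_) (sym (*-suc α r))))

    balanceD : ∀ h₁ c h' r → ((a + h₁) + suc c ≡ h' + α * suc r) ⇔ (h₁ + c ≡ h' + α * r)
    balanceD h₁ c h' r = mk⇔
      (λ e → unshift a {h' = h'} {r = α * r} (suc-injective (trans (sym (+-suc (a + h₁) c))
               (trans e (trans (cong (h' +_) (*-suc α r)) (+-suc h' (a + α * r)))))))
      (λ e → trans (+-suc (a + h₁) c) (trans (cong suc (shift a {h' = h'} {r = α * r} e))
               (trans (sym (+-suc h' (a + α * r))) (cong (h' +_) (sym (*-suc α r))))))

  slackWalk⇒ : ∀ w h h' → T (slackWalk h w h') → T (slackStays h w) × (h + Δy w ≡ h' + α * Δx w)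
  slackWalk⇒ [] h h' t = tt , (begin
    h + 0          ≡⟨ +-identityʳ h ⟩
    h              ≡⟨ sym (≡ᵇ⇒≡ h' h t) ⟩
    h'             ≡⟨ sym (+-identityʳ h') ⟩
    h' + 0         ≡⟨ cong (h' +_) (sym (*-zeroʳ α)) ⟩
    h' + α * 0     ∎)
    where open ≡-Reasoning
  slackWalk⇒ (N ∷ w) h h' t with slackWalk⇒ w (suc h) h' t
  ... | t' , e = t' , trans (+-suc h (Δy w)) e
  slackWalk⇒ (E ∷ w) h h' t with lower-inv α h _ t
  ... | h₁ , refl , t₁ with slackWalk⇒ w h₁ h' t₁
  ... | t₂ , e = lower-intro α h₁ _ t₂ , Equivalence.from (balanceE h₁ (Δy w) h' (Δx w)) e
  slackWalk⇒ (D ∷ w) h h' t with lower-inv a h _ t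
  ... | h₁ , refl , t₁ with slackWalk⇒ w h₁ h' t₁
  ... | t₂ , e = lower-intro a h₁ _ t₂ , Equivalence.from (balanceD h₁ (Δy w) h' (Δx w)) e

  ⇒slackWalk : ∀ w h h' → T (slackStays h w) → h + Δy w ≡ h' + α * Δx w → T (slackWalk h w h')
  ⇒slackWalk [] h h' t e = ≡⇒≡ᵇ h' h (begin
    h'             ≡⟨ sym (+-identityʳ h') ⟩
    h' + 0         ≡⟨ cong (h' +_) (sym (*-zeroʳ α)) ⟩
    h' + α * 0     ≡⟨ sym e ⟩
    h + 0          ≡⟨ +-identityʳ h ⟩
    h              ∎)
    where open ≡-Reasoning
  ⇒slackWalk (N ∷ w) h h' t e = ⇒slackWalk w (suc h) h' t (trans (sym (+-suc h (Δy w))) e)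
  ⇒slackWalk (E ∷ w) h h' t e with lower-inv α h _ t
  ... | h₁ , refl , t₁ =
    lower-intro α h₁ _ (⇒slackWalk w h₁ h' t₁ (Equivalence.to (balanceE h₁ (Δy w) h' (Δx w)) e))
  ⇒slackWalk (D ∷ w) h h' t e with lower-inv a h _ t
  ... | h₁ , refl , t₁ =
    lower-intro a h₁ _ (⇒slackWalk w h₁ h' t₁ (Equivalence.to (balanceD h₁ (Δy w) h' (Δx w)) e))

  DualPath : ℕ → Set
  DualPath n = Σ (List Step) (λ v → T (dualWalk 0 v 0) × Δy v ≡ n)

  private
    aboveSlope-origin : ∀ w → aboveSlope α (0 , 0) w ≡ slackStays 0 w
    aboveSlope-origin w = aboveSlope≡slackStays w 0 0 0 (sym (*-zeroʳ α))

  schroeder⇒dual : ∀ n w → T (isRatSchroeder α n w) → T (dualWalk 0 (dual w) 0) × Δy (dual w) ≡ n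
  schroeder⇒dual n w t =
    subst T (slackWalk≡dualWalk w 0 0) (⇒slackWalk w 0 0 stays (trans Δy≡ (cong (α *_) (sym Δx≡)))) ,
    trans (Δy-dual w) Δx≡
    where
      ends : (Δx w , Δy w) ≡ (n , α * n)
      ends = trans (sym (endpoint-Δ 0 0 w)) (eqPt⇒≡ _ _ (∧-fst (eqPt (endpoint (0 , 0) w) (n , α * n)) t))
      Δx≡ : Δx w ≡ n
      Δx≡ = cong proj₁ ends
      Δy≡ : Δy w ≡ α * n
      Δy≡ = cong proj₂ ends
      stays : T (slackStays 0 w)
      stays = subst T (aboveSlope-origin w) (∧-snd (eqPt (endpoint (0 , 0) w) (n , α * n)) t)

  dual⇒schroeder : ∀ n w → T (dualWalk 0 (dual w) 0) → Δy (dual w) ≡ n → T (isRatSchroeder α n w)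
  dual⇒schroeder n w t e =
    ∧-intro (≡⇒eqPt _ _ (trans (endpoint-Δ 0 0 w) (cong₂ _,_ Δx≡ (trans (proj₂ walk) (cong (α *_) Δx≡)))))
            (subst T (sym (aboveSlope-origin w)) (proj₁ walk))
    where
      walk = slackWalk⇒ w 0 0 (subst T (sym (slackWalk≡dualWalk w 0 0)) t)
      Δx≡ : Δx w ≡ n
      Δx≡ = trans (sym (Δy-dual w)) e

  schroeder↔dual : ∀ n → SchroederPath α n ↔ DualPath n
  schroeder↔dual n = subset-↔ (λ w → T-irrelevant) (λ v → T×≡-irrelevant _ _ _) dual dual
    (schroeder⇒dual n)
    (λ v (t , e) → dual⇒schroeder n (dual v)
       (subst (λ z → T (dualWalk 0 z 0)) (sym (dual-involutive v)) t)
       (trans (cong Δy (dual-involutive v)) e))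
    (λ w _ → dual-involutive w) (λ v _ → dual-involutive v)

-- Prime factorisation of dual paths

-- Along a dual path a prime raises the height by a multiple of a
-- and the E-steps between primes lower it by one.
data Prime : Set where
  diag : Prime
  arch : List Prime → Prime

data Token : Set where
  prime : Prime → Token
  east  : Token

mutual
  primePath : Prime → List Step
  primePath diag     = D ∷ []
  primePath (arch L) = N ∷ (forestPath L ++ E ∷ [])

  forestPath : List Prime → List Step
  forestPath []      = []
  forestPath (p ∷ L) = primePath p ++ forestPath L

tokensPath : List Token → List Step
tokensPath []             = []
tokensPath (prime p ∷ ts) = primePath p ++ tokensPath ts
tokensPath (east ∷ ts)    = E ∷ tokensPath ts

-- A prime of size j spans a (j+1) × (j+1) square; the size of a forest or a
-- token list is its height.
mutual
  primeSize : Prime → ℕ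
  primeSize diag     = 0
  primeSize (arch L) = forestSize L

  forestSize : List Prime → ℕ
  forestSize []      = 0
  forestSize (p ∷ L) = suc (primeSize p) + forestSize L

tokensSize : List Token → ℕ
tokensSize []             = 0
tokensSize (prime p ∷ ts) = suc (primeSize p) + tokensSize ts
tokensSize (east ∷ ts)    = tokensSize ts

mutual
  Δx-primePath : ∀ p → Δx (primePath p) ≡ suc (primeSize p)
  Δx-primePath diag     = refl
  Δx-primePath (arch L) =
    trans (Δx-++ (forestPath L) (E ∷ [])) (trans (+-comm _ 1) (cong suc (Δx-forestPath L)))

  Δx-forestPath : ∀ L → Δx (forestPath L) ≡ forestSize L
  Δx-forestPath []      = refl
  Δx-forestPath (p ∷ L) =
    trans (Δx-++ (primePath p) (forestPath L)) (cong₂ _+_ (Δx-primePath p) (Δx-forestPath L))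

mutual
  Δy-primePath : ∀ p → Δy (primePath p) ≡ suc (primeSize p)
  Δy-primePath diag     = refl
  Δy-primePath (arch L) =
    cong suc (trans (Δy-++ (forestPath L) (E ∷ [])) (trans (+-identityʳ _) (Δy-forestPath L)))

  Δy-forestPath : ∀ L → Δy (forestPath L) ≡ forestSize L
  Δy-forestPath []      = refl
  Δy-forestPath (p ∷ L) =
    trans (Δy-++ (primePath p) (forestPath L)) (cong₂ _+_ (Δy-primePath p) (Δy-forestPath L))

Δy-tokensPath : ∀ ts → Δy (tokensPath ts) ≡ tokensSize ts
Δy-tokensPath []             = refl
Δy-tokensPath (prime p ∷ ts) =
  trans (Δy-++ (primePath p) (tokensPath ts)) (cong₂ _+_ (Δy-primePath p) (Δy-tokensPath ts))
Δy-tokensPath (east ∷ ts)    = Δy-tokensPath ts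

tokensPath-forest : ∀ L ts → tokensPath (map prime L ++ ts) ≡ forestPath L ++ tokensPath ts
tokensPath-forest []      ts = refl
tokensPath-forest (p ∷ L) ts = trans (cong (primePath p ++_) (tokensPath-forest L ts))
                                     (sym (++-assoc (primePath p) (forestPath L) (tokensPath ts)))

-- Parsing reads a path from right to left; an N-step closes an arch around
-- the primes up to the first E-step to its right.
splitAtEast : List Token → Maybe (List Prime × List Token)
splitAtEast []             = nothing
splitAtEast (east ∷ ts)    = just ([] , ts)
splitAtEast (prime p ∷ ts) = mapMaybe (map₁ (p ∷_)) (splitAtEast ts)

closeWith : List Token → Maybe (List Prime × List Token) → List Token
closeWith ts (just (L , r)) = prime (arch L) ∷ r
closeWith ts nothing        = ts

closeArch : List Token → List Token
closeArch ts = closeWith ts (splitAtEast ts)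

parse : List Step → List Token
parse []      = []
parse (D ∷ w) = prime diag ∷ parse w
parse (E ∷ w) = east ∷ parse w
parse (N ∷ w) = closeArch (parse w)

splitAtEast-forest : ∀ L r → splitAtEast (map prime L ++ east ∷ r) ≡ just (L , r)
splitAtEast-forest []      r = refl
splitAtEast-forest (p ∷ L) r = cong (mapMaybe (map₁ (p ∷_))) (splitAtEast-forest L r)

mutual
  parse-primePath : ∀ p w → parse (primePath p ++ w) ≡ prime p ∷ parse w
  parse-primePath diag     w = refl
  parse-primePath (arch L) w = begin
    closeArch (parse ((forestPath L ++ E ∷ []) ++ w))
      ≡⟨ cong (closeArch ∘ parse) (++-assoc (forestPath L) (E ∷ []) w) ⟩
    closeArch (parse (forestPath L ++ E ∷ w))
      ≡⟨ cong closeArch (parse-forestPath L (E ∷ w)) ⟩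
    closeArch (map prime L ++ east ∷ parse w)
      ≡⟨ cong (closeWith (map prime L ++ east ∷ parse w)) (splitAtEast-forest L (parse w)) ⟩
    prime (arch L) ∷ parse w ∎
    where open ≡-Reasoning

  parse-forestPath : ∀ L w → parse (forestPath L ++ w) ≡ map prime L ++ parse w
  parse-forestPath []      w = refl
  parse-forestPath (p ∷ L) w =
    trans (cong parse (++-assoc (primePath p) (forestPath L) w))
      (trans (parse-primePath p (forestPath L ++ w)) (cong (prime p ∷_) (parse-forestPath L w)))

parse-tokensPath : ∀ ts → parse (tokensPath ts) ≡ ts
parse-tokensPath []             = refl
parse-tokensPath (prime p ∷ ts) =
  trans (parse-primePath p (tokensPath ts)) (cong (prime p ∷_) (parse-tokensPath ts))
parse-tokensPath (east ∷ ts)    = cong (east ∷_) (parse-tokensPath ts)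

-- Shapes: a token list up to the choice of its primes

-- The letter rise j stands for a prime of size j and fall for an E-step.
data Letter : Set where
  rise : ℕ → Letter
  fall : Letter

shapeSize : List Letter → ℕ
shapeSize []            = 0
shapeSize (rise j ∷ vs) = suc j + shapeSize vs
shapeSize (fall ∷ vs)   = shapeSize vs

riseSizes : List Letter → List ℕ
riseSizes []            = []
riseSizes (rise j ∷ vs) = j ∷ riseSizes vs
riseSizes (fall ∷ vs)   = riseSizes vs

PrimeOfSize : ℕ → Set
PrimeOfSize j = Σ Prime (λ p → primeSize p ≡ j)

shape : List Token → List Letter
shape []             = []
shape (prime p ∷ ts) = rise (primeSize p) ∷ shape ts
shape (east ∷ ts)    = fall ∷ shape ts

primesOf : ∀ ts → All PrimeOfSize (riseSizes (shape ts))
primesOf []             = []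
primesOf (prime p ∷ ts) = (p , refl) ∷ primesOf ts
primesOf (east ∷ ts)    = primesOf ts

fill : ∀ vs → All PrimeOfSize (riseSizes vs) → List Token
fill []            ps             = []
fill (rise j ∷ vs) ((p , _) ∷ ps) = prime p ∷ fill vs ps
fill (fall ∷ vs)   ps             = east ∷ fill vs ps

FilledShape : Set
FilledShape = Σ (List Letter) (λ vs → All PrimeOfSize (riseSizes vs))

fill-shape : ∀ ts → fill (shape ts) (primesOf ts) ≡ ts
fill-shape []             = refl
fill-shape (prime p ∷ ts) = cong (prime p ∷_) (fill-shape ts)
fill-shape (east ∷ ts)    = cong (east ∷_) (fill-shape ts)

shape-fill : ∀ vs ps → _≡_ {A = FilledShape} (shape (fill vs ps) , primesOf (fill vs ps)) (vs , ps)
shape-fill []                           []             = refl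
shape-fill (rise .(primeSize p) ∷ vs)   ((p , refl) ∷ ps) =
  cong (λ (ws , qs) → rise (primeSize p) ∷ ws , (p , refl) ∷ qs) (shape-fill vs ps)
shape-fill (fall ∷ vs)                  ps             =
  cong (λ (ws , qs) → fall ∷ ws , qs) (shape-fill vs ps)

tokensSize-shape : ∀ ts → tokensSize ts ≡ shapeSize (shape ts)
tokensSize-shape []             = refl
tokensSize-shape (prime p ∷ ts) = cong (suc (primeSize p) +_) (tokensSize-shape ts)
tokensSize-shape (east ∷ ts)    = tokensSize-shape ts

module Factorisation (a : ℕ) where
  open Slack a

  shapeWalk : ℕ → List Letter → ℕ → Bool
  shapeWalk g []            h = g ≡ᵇ h
  shapeWalk g (rise j ∷ vs) h = shapeWalk (a * suc j + g) vs h
  shapeWalk g (fall ∷ vs)   h = lower 1 g (λ g₁ → shapeWalk g₁ vs h)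

  -- Along a prime of size j the dual walk rises by exactly a (j + 1): an arch
  -- contributes α for its N, a times the size of its forest, and −1 for its E.
  mutual
    dualWalk-primePath : ∀ p w g h →
      dualWalk g (primePath p ++ w) h ≡ dualWalk (a * suc (primeSize p) + g) w h
    dualWalk-primePath diag     w g h = cong (λ z → dualWalk (z + g) w h) (sym (*-identityʳ a))
    dualWalk-primePath (arch L) w g h = begin
      dualWalk (α + g) ((forestPath L ++ E ∷ []) ++ w) h
        ≡⟨ cong (λ z → dualWalk (α + g) z h) (++-assoc (forestPath L) (E ∷ []) w) ⟩
      dualWalk (α + g) (forestPath L ++ E ∷ w) h
        ≡⟨ dualWalk-forestPath L (E ∷ w) (α + g) h ⟩
      dualWalk (a * s + suc (a + g)) (E ∷ w) h
        ≡⟨ cong (λ z → dualWalk z (E ∷ w) h) (+-suc (a * s) (a + g)) ⟩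
      dualWalk (a * s + (a + g)) w h
        ≡⟨ cong (λ z → dualWalk z w h) (trans (sym (+-assoc (a * s) a g))
             (cong (_+ g) (trans (+-comm (a * s) a) (sym (*-suc a s))))) ⟩
      dualWalk (a * suc s + g) w h ∎
      where open ≡-Reasoning
            s = forestSize L

    dualWalk-forestPath : ∀ L w g h →
      dualWalk g (forestPath L ++ w) h ≡ dualWalk (a * forestSize L + g) w h
    dualWalk-forestPath []      w g h = cong (λ z → dualWalk (z + g) w h) (sym (*-zeroʳ a))
    dualWalk-forestPath (p ∷ L) w g h = begin
      dualWalk g ((primePath p ++ forestPath L) ++ w) h
        ≡⟨ cong (λ z → dualWalk g z h) (++-assoc (primePath p) (forestPath L) w) ⟩
      dualWalk g (primePath p ++ forestPath L ++ w) h
        ≡⟨ dualWalk-primePath p (forestPath L ++ w) g h ⟩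
      dualWalk (a * s + g) (forestPath L ++ w) h
        ≡⟨ dualWalk-forestPath L w (a * s + g) h ⟩
      dualWalk (a * t + (a * s + g)) w h
        ≡⟨ cong (λ z → dualWalk z w h) (trans (sym (+-assoc (a * t) (a * s) g))
             (cong (_+ g) (trans (+-comm (a * t) (a * s)) (sym (*-distribˡ-+ a s t))))) ⟩
      dualWalk (a * (s + t) + g) w h ∎
      where open ≡-Reasoning
            s = suc (primeSize p)
            t = forestSize L

  dualWalk-tokensPath : ∀ ts g h → dualWalk g (tokensPath ts) h ≡ shapeWalk g (shape ts) h
  dualWalk-tokensPath []             g       h = refl
  dualWalk-tokensPath (prime p ∷ ts) g       h =
    trans (dualWalk-primePath p (tokensPath ts) g h) (dualWalk-tokensPath ts _ h)
  dualWalk-tokensPath (east ∷ ts)    zero    h = refl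
  dualWalk-tokensPath (east ∷ ts)    (suc g) h = dualWalk-tokensPath ts g h

  -- When an N-step is read at a height from which the rest of the walk can
  -- come down, the tokens to its right begin with a forest followed by an E.
  splitAtEast-valid : ∀ ts k → T (shapeWalk (suc k) (shape ts) 0) →
    Σ (List Prime) λ L → Σ (List Token) λ r →
      splitAtEast ts ≡ just (L , r) × ts ≡ map prime L ++ east ∷ r
  splitAtEast-valid (east ∷ ts)    k t = [] , ts , refl , refl
  splitAtEast-valid (prime p ∷ ts) k t
    with splitAtEast-valid ts (a * suc (primeSize p) + k)
           (subst (λ z → T (shapeWalk z (shape ts) 0)) (+-suc (a * suc (primeSize p)) k) t)
  ... | L , r , split , eq = p ∷ L , r , cong (mapMaybe (map₁ (p ∷_))) split , cong (prime p ∷_) eq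

  tokensPath-parse : ∀ v g → T (dualWalk g v 0) → tokensPath (parse v) ≡ v
  tokensPath-parse []      g       t = refl
  tokensPath-parse (D ∷ v) g       t = cong (D ∷_) (tokensPath-parse v (a + g) t)
  tokensPath-parse (E ∷ v) (suc g) t = cong (E ∷_) (tokensPath-parse v g t)
  tokensPath-parse (N ∷ v) g       t with tokensPath-parse v (α + g) t
  ... | ih with splitAtEast-valid (parse v) (a + g)
                  (subst T (dualWalk-tokensPath (parse v) (α + g) 0)
                    (subst (λ z → T (dualWalk (α + g) z 0)) (sym ih) t))
  ... | L , r , split , eq = begin
    tokensPath (closeWith (parse v) (splitAtEast (parse v)))
      ≡⟨ cong (tokensPath ∘ closeWith (parse v)) split ⟩
    N ∷ ((forestPath L ++ E ∷ []) ++ tokensPath r)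
      ≡⟨ cong (N ∷_) (++-assoc (forestPath L) (E ∷ []) (tokensPath r)) ⟩
    N ∷ (forestPath L ++ tokensPath (east ∷ r))
      ≡⟨ cong (N ∷_) (sym (tokensPath-forest L (east ∷ r))) ⟩
    N ∷ tokensPath (map prime L ++ east ∷ r)
      ≡⟨ cong (λ z → N ∷ tokensPath z) (sym eq) ⟩
    N ∷ tokensPath (parse v)
      ≡⟨ cong (N ∷_) ih ⟩
    N ∷ v ∎
    where open ≡-Reasoning

  ValidShape : ℕ → List Letter → Set
  ValidShape n vs = T (shapeWalk 0 vs 0) × shapeSize vs ≡ n

  dual↔tokens : ∀ n → DualPath n ↔ Σ (List Token) (λ ts → ValidShape n (shape ts))
  dual↔tokens n = subset-↔ (λ _ → T×≡-irrelevant _ _ _) (λ _ → T×≡-irrelevant _ _ _) parse tokensPath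
    (λ v (t , e) → let flat = tokensPath-parse v 0 t in
       subst T (dualWalk-tokensPath (parse v) 0 0) (subst (λ z → T (dualWalk 0 z 0)) (sym flat) t) ,
       trans (sym (tokensSize-shape (parse v)))
         (trans (sym (Δy-tokensPath (parse v))) (trans (cong Δy flat) e)))
    (λ ts (t , e) → subst T (sym (dualWalk-tokensPath ts 0 0)) t ,
       trans (Δy-tokensPath ts) (trans (tokensSize-shape ts) e))
    (λ v (t , _) → tokensPath-parse v 0 t) (λ ts _ → parse-tokensPath ts)

  tokens↔shapes : ∀ n → Σ (List Token) (λ ts → ValidShape n (shape ts)) ↔
                        Σ FilledShape (λ (vs , _) → ValidShape n vs)
  tokens↔shapes n = subset-↔ (λ _ → T×≡-irrelevant _ _ _) (λ _ → T×≡-irrelevant _ _ _)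
    (λ ts → shape ts , primesOf ts) (λ (vs , ps) → fill vs ps)
    (λ ts valid → valid)
    (λ (vs , ps) valid → subst (ValidShape n) (sym (cong proj₁ (shape-fill vs ps))) valid)
    (λ ts _ → fill-shape ts) (λ (vs , ps) _ → shape-fill vs ps)

replicate-snoc : ∀ {A : Set} c (x : A) w → replicate (suc c) x ++ w ≡ replicate c x ++ x ∷ w
replicate-snoc zero    x w = refl
replicate-snoc (suc c) x w = cong (x ∷_) (replicate-snoc c x w)

≡-↔ : ∀ {A : Set} (F : A → Set) {x y} → x ≡ y → F x ↔ F y
≡-↔ F refl = ↔-refl

All∷↔ : ∀ {A : Set} {P : A → Set} {x xs} → All P (x ∷ xs) ↔ (P x × All P xs)
All∷↔ = mk↔ₛ′ (λ { (p ∷ ps) → p , ps }) (λ (p , ps) → p ∷ ps) (λ _ → refl) (λ { (p ∷ ps) → refl })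

All[]↔ : ∀ {A B : Set} {P : A → Set} {Q : B → Set} → All P [] ↔ All Q []
All[]↔ = mk↔ₛ′ (λ { [] → [] }) (λ { [] → [] }) (λ { [] → refl }) (λ { [] → refl })

All-↔ : ∀ {A : Set} {P Q : A → Set} → (∀ x → P x ↔ Q x) → ∀ xs → All P xs ↔ All Q xs
All-↔ P↔Q []       = All[]↔
All-↔ P↔Q (x ∷ xs) = ↔-trans All∷↔ (↔-trans (P↔Q x ×-↔ All-↔ P↔Q xs) (↔-sym All∷↔))

-- Admissible Dyck words are the Dyck words of valid shapes, for α = a + 1

module DyckShapes (a : ℕ) where
  open Slack a using (α)
  open Factorisation a using (shapeWalk; ValidShape)

  dyckWord : List Letter → List UD
  dyckWord []            = []
  dyckWord (rise j ∷ vs) = replicate (α * suc j) u ++ replicate (suc j) d ++ dyckWord vs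
  dyckWord (fall ∷ vs)   = d ∷ dyckWord vs

  -- Reading a word back: an ascent of length k gives rise (k/α − 1), the first
  -- k/α down-steps after it belong to its block, further ones are falls.
  mutual
    readDowns : ℕ → List UD → List Letter
    readDowns i       []      = []
    readDowns zero    (d ∷ w) = fall ∷ readDowns zero w
    readDowns (suc i) (d ∷ w) = readDowns i w
    readDowns i       (u ∷ w) = readAscent 1 w

    readAscent : ℕ → List UD → List Letter
    readAscent k []      = []
    readAscent k (u ∷ w) = readAscent (suc k) w
    readAscent k (d ∷ w) = rise (k / α ∸ 1) ∷ readDowns (k / α ∸ 1) w

  readLetters : List UD → List Letter
  readLetters = readDowns 0

  private
    okAscent-length : ∀ k m → T (okAscent a (k , m)) → T (1 ≤ᵇ k / α) × T ((k / α) * α ≡ᵇ k)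
    okAscent-length k m ok = ∧-fst (1 ≤ᵇ k / α) ok , ∧-fst ((k / α) * α ≡ᵇ k) (∧-snd (1 ≤ᵇ k / α) ok)

    okAscent-downs : ∀ k m → T (okAscent a (k , m)) → k / α ≤ m
    okAscent-downs k m ok = ≤ᵇ⇒≤ (k / α) m (∧-snd ((k / α) * α ≡ᵇ k) (∧-snd (1 ≤ᵇ k / α) ok))

    firstAscent-length : ∀ k m w → T (allB (okAscent a) (inD k m w)) →
      T (1 ≤ᵇ k / α) × T ((k / α) * α ≡ᵇ k)
    firstAscent-length k m []      t = okAscent-length k m (∧-fst (okAscent a (k , m)) t)
    firstAscent-length k m (d ∷ w) t = firstAscent-length k (suc m) w t
    firstAscent-length k m (u ∷ w) t = okAscent-length k m (∧-fst (okAscent a (k , m)) t)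

  -- The
  -- two mutual lemmas follow the reading in the middle of a block of downs
  -- (k the ascent length, m the downs seen, i the downs still owed) and in
  -- the middle of an ascent of length c so far.
  mutual
    rebuild-downs : ∀ k m i w → i ≡ k / α ∸ m → T (allB (okAscent a) (inD k m w)) →
      replicate i d ++ dyckWord (readDowns i w) ≡ w
    rebuild-downs k m i [] e t
      rewrite e | m≤n⇒m∸n≡0 (okAscent-downs k m (∧-fst (okAscent a (k , m)) t)) = refl
    rebuild-downs k m zero (d ∷ w) e t = cong (d ∷_) (rebuild-downs k (suc m) zero w
      (sym (trans (sym (pred[m∸n]≡m∸[1+n] (k / α) m)) (cong pred (sym e)))) t)
    rebuild-downs k m (suc i) (d ∷ w) e t = cong (d ∷_) (rebuild-downs k (suc m) i w
      (trans (cong pred e) (pred[m∸n]≡m∸[1+n] (k / α) m)) t)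
    rebuild-downs k m i (u ∷ w) e t
      rewrite e | m≤n⇒m∸n≡0 (okAscent-downs k m (∧-fst (okAscent a (k , m)) t)) =
      rebuild-ascent 1 w (∧-snd (okAscent a (k , m)) t)

    rebuild-ascent : ∀ c w → T (allB (okAscent a) (inU c w)) →
      dyckWord (readAscent c w) ≡ replicate c u ++ w
    rebuild-ascent c [] t =
      ⊥-elim (<⇒≱ (≤ᵇ⇒≤ 1 (c / α) (proj₁ (okAscent-length c 0 ok))) (okAscent-downs c 0 ok))
      where ok = ∧-fst (okAscent a (c , 0)) t
    rebuild-ascent c (u ∷ w) t = trans (rebuild-ascent (suc c) w t) (replicate-snoc c u w)
    rebuild-ascent c (d ∷ w) t = rebuild-block (c / α) refl (firstAscent-length c 1 w t)
      where
        rebuild-block : ∀ s → c / α ≡ s → T (1 ≤ᵇ s) × T (s * α ≡ᵇ c) →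
          dyckWord (readAscent c (d ∷ w)) ≡ replicate c u ++ d ∷ w
        rebuild-block (suc j) e (_ , divides) rewrite e =
          cong₂ (λ z z' → replicate z u ++ (d ∷ z'))
                (trans (*-comm α (suc j)) (≡ᵇ⇒≡ _ _ divides))
                (rebuild-downs c 1 j w (cong (_∸ 1) (sym e)) t)

  dyckWord-readLetters : ∀ w → T (allB (okAscent a) (ascentData w)) → dyckWord (readLetters w) ≡ w
  dyckWord-readLetters []      t = refl
  dyckWord-readLetters (d ∷ w) t = cong (d ∷_) (dyckWord-readLetters w t)
  dyckWord-readLetters (u ∷ w) t = rebuild-ascent 1 w t

  private
    readAscent-ups : ∀ c i w → readAscent c (replicate i u ++ w) ≡ readAscent (i + c) w
    readAscent-ups c zero    w = refl
    readAscent-ups c (suc i) w = trans (readAscent-ups (suc c) i w) (cong (λ z → readAscent z w) (+-suc i c))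

    readDowns-downs : ∀ i w → readDowns i (replicate i d ++ w) ≡ readLetters w
    readDowns-downs zero    w = refl
    readDowns-downs (suc i) w = readDowns-downs i w

  block/α : ∀ j → (α * suc j) / α ≡ suc j
  block/α j = trans (cong (_/ α) (*-comm α (suc j))) (m*n/n≡m (suc j) α)

  readLetters-dyckWord : ∀ vs → readLetters (dyckWord vs) ≡ vs
  readLetters-dyckWord []            = refl
  readLetters-dyckWord (fall ∷ vs)   = cong (fall ∷_) (readLetters-dyckWord vs)
  readLetters-dyckWord (rise j ∷ vs) = begin
    readAscent 1 (replicate (j + a * suc j) u ++ rest)
      ≡⟨ readAscent-ups 1 (j + a * suc j) rest ⟩
    readAscent (j + a * suc j + 1) rest
      ≡⟨ cong (λ z → readAscent z rest) (+-comm (j + a * suc j) 1) ⟩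
    rise ((α * suc j) / α ∸ 1) ∷ readDowns ((α * suc j) / α ∸ 1) (replicate j d ++ dyckWord vs)
      ≡⟨ cong (λ z → rise (z ∸ 1) ∷ readDowns (z ∸ 1) (replicate j d ++ dyckWord vs)) (block/α j) ⟩
    rise j ∷ readDowns j (replicate j d ++ dyckWord vs)
      ≡⟨ cong (rise j ∷_) (trans (readDowns-downs j (dyckWord vs)) (readLetters-dyckWord vs)) ⟩
    rise j ∷ vs ∎
    where open ≡-Reasoning
          rest = d ∷ (replicate j d ++ dyckWord vs)

  -- The Dyck condition on dyckWord vs is the shape walk: a block of rise j
  -- raises the height by α (j+1) − (j+1) = a (j+1).
  private
    dyckFrom-ups : ∀ i g w → dyckFrom g (replicate i u ++ w) ≡ dyckFrom (i + g) w
    dyckFrom-ups zero    g w = refl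
    dyckFrom-ups (suc i) g w = trans (dyckFrom-ups i (suc g) w) (cong (λ z → dyckFrom z w) (+-suc i g))

    dyckFrom-downs : ∀ i g w → dyckFrom (i + g) (replicate i d ++ w) ≡ dyckFrom g w
    dyckFrom-downs zero    g w = refl
    dyckFrom-downs (suc i) g w = dyckFrom-downs i g w

  dyckFrom-dyckWord : ∀ vs g → dyckFrom g (dyckWord vs) ≡ shapeWalk g vs 0
  dyckFrom-dyckWord []            g       = refl
  dyckFrom-dyckWord (fall ∷ vs)   zero    = refl
  dyckFrom-dyckWord (fall ∷ vs)   (suc g) = dyckFrom-dyckWord vs g
  dyckFrom-dyckWord (rise j ∷ vs) g       = begin
    dyckFrom g (replicate (α * suc j) u ++ replicate (suc j) d ++ dyckWord vs)
      ≡⟨ dyckFrom-ups (α * suc j) g _ ⟩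
    dyckFrom ((suc j + a * suc j) + g) (replicate (suc j) d ++ dyckWord vs)
      ≡⟨ cong (λ z → dyckFrom z (replicate (suc j) d ++ dyckWord vs)) (+-assoc (suc j) (a * suc j) g) ⟩
    dyckFrom (suc j + (a * suc j + g)) (replicate (suc j) d ++ dyckWord vs)
      ≡⟨ dyckFrom-downs (suc j) (a * suc j + g) (dyckWord vs) ⟩
    dyckFrom (a * suc j + g) (dyckWord vs)
      ≡⟨ dyckFrom-dyckWord vs (a * suc j + g) ⟩
    shapeWalk (a * suc j + g) vs 0 ∎
    where open ≡-Reasoning

  -- The length of dyckWord vs is 2 α n for a valid shape of size n: a shape
  -- walk returning to 0 has exactly a n falls.
  falls : List Letter → ℕ
  falls []            = 0
  falls (rise j ∷ vs) = falls vs
  falls (fall ∷ vs)   = suc (falls vs)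

  shapeWalk-falls : ∀ vs g h → T (shapeWalk g vs h) → g + a * shapeSize vs ≡ h + falls vs
  shapeWalk-falls []            g       h t = begin
    g + a * 0 ≡⟨ cong (g +_) (*-zeroʳ a) ⟩
    g + 0     ≡⟨ +-identityʳ g ⟩
    g         ≡⟨ ≡ᵇ⇒≡ g h t ⟩
    h         ≡⟨ sym (+-identityʳ h) ⟩
    h + 0     ∎
    where open ≡-Reasoning
  shapeWalk-falls (rise j ∷ vs) g       h t = begin
    g + a * (suc j + shapeSize vs)     ≡⟨ cong (g +_) (*-distribˡ-+ a (suc j) (shapeSize vs)) ⟩
    g + (a * suc j + a * shapeSize vs) ≡⟨ x∙yz≈y∙xz g (a * suc j) (a * shapeSize vs) ⟩
    a * suc j + (g + a * shapeSize vs) ≡⟨ sym (+-assoc (a * suc j) g (a * shapeSize vs)) ⟩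
    (a * suc j + g) + a * shapeSize vs ≡⟨ shapeWalk-falls vs (a * suc j + g) h t ⟩
    h + falls vs                        ∎
    where open ≡-Reasoning
  shapeWalk-falls (fall ∷ vs)   (suc g) h t =
    trans (cong suc (shapeWalk-falls vs g h t)) (sym (+-suc h (falls vs)))

  length-dyckWord : ∀ vs → length (dyckWord vs) ≡ α * shapeSize vs + shapeSize vs + falls vs
  length-dyckWord []            = sym (cong (λ z → z + 0 + 0) (*-zeroʳ α))
  length-dyckWord (fall ∷ vs)   = trans (cong suc (length-dyckWord vs)) (sym (+-suc _ (falls vs)))
  length-dyckWord (rise j ∷ vs) =
    trans (length-++ (replicate (α * suc j) u))
      (trans (cong₂ _+_ (length-replicate (α * suc j))
                 (trans (length-++ (replicate (suc j) d))
                        (cong₂ _+_ (length-replicate (suc j)) (length-dyckWord vs))))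
        (rearrange j a (shapeSize vs) (falls vs)))
    where
      rearrange : ∀ j a S e → (suc j + a * suc j) + (suc j + ((S + a * S) + S + e)) ≡
                               ((suc j + S) + a * (suc j + S)) + (suc j + S) + e
      rearrange = solve-∀

  length-valid : ∀ vs → T (shapeWalk 0 vs 0) → length (dyckWord vs) ≡ 2 * (α * shapeSize vs)
  length-valid vs t =
    trans (length-dyckWord vs)
      (trans (cong (α * shapeSize vs + shapeSize vs +_) (sym (shapeWalk-falls vs 0 0 t)))
             (double (shapeSize vs) a))
    where
      double : ∀ S a → (S + a * S) + S + a * S ≡ 2 * (S + a * S)
      double = solve-∀

  mutual
    ascents : List Letter → List (ℕ × ℕ)
    ascents []            = []
    ascents (fall ∷ vs)   = ascents vs
    ascents (rise j ∷ vs) = ascentsAfter (α * suc j) (suc j) vs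

    ascentsAfter : ℕ → ℕ → List Letter → List (ℕ × ℕ)
    ascentsAfter k m []            = (k , m) ∷ []
    ascentsAfter k m (fall ∷ vs)   = ascentsAfter k (suc m) vs
    ascentsAfter k m (rise j ∷ vs) = (k , m) ∷ ascentsAfter (α * suc j) (suc j) vs

  private
    inU-ups : ∀ c i w → inU c (replicate i u ++ w) ≡ inU (i + c) w
    inU-ups c zero    w = refl
    inU-ups c (suc i) w = trans (inU-ups (suc c) i w) (cong (λ z → inU z w) (+-suc i c))

    inD-downs : ∀ k m i w → inD k m (replicate i d ++ w) ≡ inD k (i + m) w
    inD-downs k m zero    w = refl
    inD-downs k m (suc i) w = trans (inD-downs k (suc m) i w) (cong (λ z → inD k z w) (+-suc i m))

  mutual
    inD-dyckWord : ∀ k m vs → inD k m (dyckWord vs) ≡ ascentsAfter k m vs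
    inD-dyckWord k m []            = refl
    inD-dyckWord k m (fall ∷ vs)   = inD-dyckWord k (suc m) vs
    inD-dyckWord k m (rise j ∷ vs) = cong ((k , m) ∷_) (inU-block j vs)

    inU-block : ∀ j vs → inU 1 (replicate (j + a * suc j) u ++ replicate (suc j) d ++ dyckWord vs) ≡
                         ascentsAfter (α * suc j) (suc j) vs
    inU-block j vs = begin
      inU 1 (replicate (j + a * suc j) u ++ downs)
        ≡⟨ inU-ups 1 (j + a * suc j) downs ⟩
      inU (j + a * suc j + 1) downs
        ≡⟨ cong (λ z → inU z downs) (+-comm (j + a * suc j) 1) ⟩
      inD (α * suc j) 1 (replicate j d ++ dyckWord vs)
        ≡⟨ inD-downs (α * suc j) 1 j (dyckWord vs) ⟩
      inD (α * suc j) (j + 1) (dyckWord vs)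
        ≡⟨ cong (λ z → inD (α * suc j) z (dyckWord vs)) (+-comm j 1) ⟩
      inD (α * suc j) (suc j) (dyckWord vs)
        ≡⟨ inD-dyckWord (α * suc j) (suc j) vs ⟩
      ascentsAfter (α * suc j) (suc j) vs ∎
      where open ≡-Reasoning
            downs = replicate (suc j) d ++ dyckWord vs

  ascentData-dyckWord : ∀ vs → ascentData (dyckWord vs) ≡ ascents vs
  ascentData-dyckWord []            = refl
  ascentData-dyckWord (fall ∷ vs)   = ascentData-dyckWord vs
  ascentData-dyckWord (rise j ∷ vs) = inU-block j vs

  okAscent-block : ∀ j m → suc j ≤ m → T (okAscent a (α * suc j , m))
  okAscent-block j m le rewrite block/α j =
    ∧-intro {1 ≤ᵇ suc j} tt (∧-intro (≡⇒≡ᵇ _ _ (*-comm (suc j) α)) (≤⇒≤ᵇ le))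

  ascentsAfter-admissible : ∀ j m vs → suc j ≤ m → T (allB (okAscent a) (ascentsAfter (α * suc j) m vs))
  ascentsAfter-admissible j m []             le = ∧-intro (okAscent-block j m le) tt
  ascentsAfter-admissible j m (fall ∷ vs)    le = ascentsAfter-admissible j (suc m) vs (m≤n⇒m≤1+n le)
  ascentsAfter-admissible j m (rise j' ∷ vs) le =
    ∧-intro (okAscent-block j m le) (ascentsAfter-admissible j' (suc j') vs ≤-refl)

  ascents-admissible : ∀ vs → T (allB (okAscent a) (ascents vs))
  ascents-admissible []            = tt
  ascents-admissible (fall ∷ vs)   = ascents-admissible vs
  ascents-admissible (rise j ∷ vs) = ascentsAfter-admissible j (suc j) vs ≤-refl

  AdmissibleDyck : ℕ → Set
  AdmissibleDyck n = Σ (List UD) (λ w → T (isADyck a n w))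

  admissible-ascents : ∀ n w → T (isADyck a n w) → T (allB (okAscent a) (ascentData w))
  admissible-ascents n w t = ∧-snd (length w ≡ᵇ 2 * (α * n)) (∧-snd (isDyck w) t)

  admissibleDyck↔validShapes : ∀ n → AdmissibleDyck n ↔ Σ (List Letter) (ValidShape n)
  admissibleDyck↔validShapes n =
    subset-↔ (λ _ → T-irrelevant) (λ _ → T×≡-irrelevant _ _ _) readLetters dyckWord valid admissible
      (λ w t → dyckWord-readLetters w (admissible-ascents n w t)) (λ vs _ → readLetters-dyckWord vs)
    where

      valid : ∀ w → T (isADyck a n w) → ValidShape n (readLetters w)
      valid w t = walk , *-cancelˡ-≡ _ n α (*-cancelˡ-≡ _ _ 2 (begin
        2 * (α * shapeSize vs)  ≡⟨ sym (length-valid vs walk) ⟩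
        length (dyckWord vs)    ≡⟨ cong length rebuilt ⟩
        length w                ≡⟨ ≡ᵇ⇒≡ _ _ (∧-fst (length w ≡ᵇ 2 * (α * n)) (∧-snd (isDyck w) t)) ⟩
        2 * (α * n)             ∎))
        where
          open ≡-Reasoning
          vs = readLetters w
          rebuilt : dyckWord vs ≡ w
          rebuilt = dyckWord-readLetters w (admissible-ascents n w t)
          walk : T (shapeWalk 0 vs 0)
          walk = subst T (dyckFrom-dyckWord vs 0) (subst (T ∘ dyckFrom 0) (sym rebuilt) (∧-fst (isDyck w) t))

      admissible : ∀ vs → ValidShape n vs → T (isADyck a n (dyckWord vs))
      admissible vs (walk , size) =
        ∧-intro (subst T (sym (dyckFrom-dyckWord vs 0)) walk)
          (∧-intro (≡⇒≡ᵇ _ _ (trans (length-valid vs walk) (cong (λ z → 2 * (α * z)) size)))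
                   (subst (T ∘ allB (okAscent a)) (sym (ascentData-dyckWord vs)) (ascents-admissible vs)))

  -- Colourings: an ascent of length k carries one of σ (k / α) colours, so the
  -- ascent of a block rise j carries one of σ (j + 1).
  AscentColour : ℕ × ℕ → Set
  AscentColour km = Fin (σ (proj₁ km / suc a))

  RiseColour : ℕ → Set
  RiseColour j = Fin (σ (suc j))

  mutual
    colours-ascents : ∀ vs → All AscentColour (ascents vs) ↔ All RiseColour (riseSizes vs)
    colours-ascents []            = All[]↔
    colours-ascents (fall ∷ vs)   = colours-ascents vs
    colours-ascents (rise j ∷ vs) =
      ↔-trans (colours-ascentsAfter (α * suc j) (suc j) vs)
        (↔-trans (≡-↔ (Fin ∘ σ) (block/α j) ×-↔ ↔-refl) (↔-sym All∷↔))

    colours-ascentsAfter : ∀ k m vs →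
      All AscentColour (ascentsAfter k m vs) ↔ (Fin (σ (k / α)) × All RiseColour (riseSizes vs))
    colours-ascentsAfter k m []            = ↔-trans All∷↔ (↔-refl ×-↔ All[]↔)
    colours-ascentsAfter k m (fall ∷ vs)   = colours-ascentsAfter k (suc m) vs
    colours-ascentsAfter k m (rise j ∷ vs) = ↔-trans All∷↔ (↔-refl ×-↔ colours-ascents (rise j ∷ vs))

  colouredDyck↔colouredShapes : ∀ n → ColoredDyck a σ n ↔
    Σ (Σ (List Letter) (ValidShape n)) (λ (vs , _) → All RiseColour (riseSizes vs))
  colouredDyck↔colouredShapes n =
    ↔-trans (↔-sym Σ-assoc) (Σ-↔ (admissibleDyck↔validShapes n) (λ {x} → recolour x))
    where
      recolour : ∀ ((w , t) : AdmissibleDyck n) →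
        All AscentColour (ascentData w) ↔ All RiseColour (riseSizes (readLetters w))
      recolour (w , t) =
        ↔-trans (≡-↔ (All AscentColour ∘ ascentData) (sym (dyckWord-readLetters w (admissible-ascents n w t))))
          (↔-trans (≡-↔ (All AscentColour) (ascentData-dyckWord (readLetters w)))
                   (colours-ascents (readLetters w)))

-- Primes of size j are counted by σ (j + 1) = 2 s_j

-- A little Schröder path is a sequence of arches N f E starting on the
-- diagonal, f a forest; it is recorded by the list of these forests.
archesSize : List (List Prime) → ℕ
archesSize []       = 0
archesSize (L ∷ ls) = suc (forestSize L) + archesSize ls

Arches : ℕ → Set
Arches j = Σ (List (List Prime)) (λ ls → archesSize ls ≡ j)

-- A forest either consists of arches only, or is qs ++ diag ∷ (arches rs)
-- split at its last D-step.
ForestSplit : Set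
ForestSplit = List (List Prime) ⊎ (List Prime × List (List Prime))

consArch : List Prime → ForestSplit → ForestSplit
consArch L (inj₁ ls)        = inj₁ (L ∷ ls)
consArch L (inj₂ (qs , rs)) = inj₂ (arch L ∷ qs , rs)

consDiag : ForestSplit → ForestSplit
consDiag (inj₁ ls)        = inj₂ ([] , ls)
consDiag (inj₂ (qs , rs)) = inj₂ (diag ∷ qs , rs)

splitForest : List Prime → ForestSplit
splitForest []           = inj₁ []
splitForest (diag ∷ ps)   = consDiag (splitForest ps)
splitForest (arch L ∷ ps) = consArch L (splitForest ps)

joinForest : ForestSplit → List Prime
joinForest (inj₁ ls)        = map arch ls
joinForest (inj₂ (qs , rs)) = qs ++ diag ∷ map arch rs

joinForest-splitForest : ∀ ps → joinForest (splitForest ps) ≡ ps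
joinForest-splitForest []            = refl
joinForest-splitForest (diag ∷ ps)   = trans (join-consDiag (splitForest ps)) (cong (diag ∷_) (joinForest-splitForest ps))
  where
    join-consDiag : ∀ x → joinForest (consDiag x) ≡ diag ∷ joinForest x
    join-consDiag (inj₁ ls)        = refl
    join-consDiag (inj₂ (qs , rs)) = refl
joinForest-splitForest (arch L ∷ ps) = trans (join-consArch (splitForest ps)) (cong (arch L ∷_) (joinForest-splitForest ps))
  where
    join-consArch : ∀ x → joinForest (consArch L x) ≡ arch L ∷ joinForest x
    join-consArch (inj₁ ls)        = refl
    join-consArch (inj₂ (qs , rs)) = refl

splitForest-arches : ∀ ls → splitForest (map arch ls) ≡ inj₁ ls
splitForest-arches []       = refl
splitForest-arches (L ∷ ls) = cong (consArch L) (splitForest-arches ls)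

splitForest-lastDiag : ∀ qs rs → splitForest (qs ++ diag ∷ map arch rs) ≡ inj₂ (qs , rs)
splitForest-lastDiag []            rs = cong consDiag (splitForest-arches rs)
splitForest-lastDiag (diag ∷ qs)   rs = cong consDiag (splitForest-lastDiag qs rs)
splitForest-lastDiag (arch L ∷ qs) rs = cong (consArch L) (splitForest-lastDiag qs rs)

forestSize-arches : ∀ ls → forestSize (map arch ls) ≡ archesSize ls
forestSize-arches []       = refl
forestSize-arches (L ∷ ls) = cong (suc (forestSize L) +_) (forestSize-arches ls)

forestSize-++ : ∀ qs ps → forestSize (qs ++ ps) ≡ forestSize qs + forestSize ps
forestSize-++ []      ps = refl
forestSize-++ (p ∷ qs) ps =
  trans (cong (suc (primeSize p) +_) (forestSize-++ qs ps)) (sym (+-assoc (suc (primeSize p)) (forestSize qs) (forestSize ps)))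

-- A prime of size j is coded by a bit and a list of arches of total size j:
-- arch (arches ls) ↦ (0, ls), and the prime D resp. arch (q ++ D ∷ arches rs)
-- ↦ (1, []) resp. (1, q ∷ rs).
splitSize : ForestSplit → ℕ
splitSize (inj₁ ls)        = archesSize ls
splitSize (inj₂ (qs , rs)) = suc (forestSize qs + archesSize rs)

forestSize-splitForest : ∀ ps → forestSize ps ≡ splitSize (splitForest ps)
forestSize-splitForest ps = trans (cong forestSize (sym (joinForest-splitForest ps))) (size-join (splitForest ps))
  where
    size-join : ∀ x → forestSize (joinForest x) ≡ splitSize x
    size-join (inj₁ ls)        = forestSize-arches ls
    size-join (inj₂ (qs , rs)) = trans (forestSize-++ qs (diag ∷ map arch rs))
      (trans (+-suc (forestSize qs) (forestSize (map arch rs)))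
             (cong (λ z → suc (forestSize qs + z)) (forestSize-arches rs)))

codeSplit : ForestSplit → Fin 2 × List (List Prime)
codeSplit (inj₁ ls)        = zero , ls
codeSplit (inj₂ (qs , rs)) = suc zero , qs ∷ rs

primeCode : Prime → Fin 2 × List (List Prime)
primeCode diag     = suc zero , []
primeCode (arch L) = codeSplit (splitForest L)

primeDecode : Fin 2 × List (List Prime) → Prime
primeDecode (zero , ls)         = arch (map arch ls)
primeDecode (suc zero , [])     = diag
primeDecode (suc zero , q ∷ rs) = arch (q ++ diag ∷ map arch rs)

primeDecode-primeCode : ∀ p → primeDecode (primeCode p) ≡ p
primeDecode-primeCode diag     = refl
primeDecode-primeCode (arch L) = trans (decode-code (splitForest L)) (cong arch (joinForest-splitForest L))
  where
    decode-code : ∀ x → primeDecode (codeSplit x) ≡ arch (joinForest x)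
    decode-code (inj₁ ls)        = refl
    decode-code (inj₂ (qs , rs)) = refl

primeCode-primeDecode : ∀ y → primeCode (primeDecode y) ≡ y
primeCode-primeDecode (zero , ls)         = cong codeSplit (splitForest-arches ls)
primeCode-primeDecode (suc zero , [])     = refl
primeCode-primeDecode (suc zero , q ∷ rs) = cong codeSplit (splitForest-lastDiag q rs)

primeSize-primeCode : ∀ p → primeSize p ≡ archesSize (proj₂ (primeCode p))
primeSize-primeCode diag     = refl
primeSize-primeCode (arch L) = trans (forestSize-splitForest L) (size-code (splitForest L))
  where
    size-code : ∀ x → splitSize x ≡ archesSize (proj₂ (codeSplit x))
    size-code (inj₁ ls)        = refl
    size-code (inj₂ (qs , rs)) = refl

primes↔2×arches : ∀ j → PrimeOfSize j ↔ (Fin 2 × Arches j)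
primes↔2×arches j = ↔-trans
  (subset-↔ (λ _ → ≡-irrelevant) (λ _ → ≡-irrelevant) primeCode primeDecode
     (λ p e → trans (sym (primeSize-primeCode p)) e)
     (λ y e → trans (trans (primeSize-primeCode (primeDecode y))
                           (cong (archesSize ∘ proj₂) (primeCode-primeDecode y))) e)
     (λ p _ → primeDecode-primeCode p) (λ y _ → primeCode-primeDecode y))
  Σ-assoc

-- Little Schröder paths are exactly the arch sequences
module S₀ = Slack 0
module F₀ = Factorisation 0

slackWalk≡dualWalk₀ : ∀ w h h' → S₀.slackWalk h w h' ≡ S₀.dualWalk h w h'
slackWalk≡dualWalk₀ []      h h' = ≡ᵇ-sym h' h
  where
    ≡ᵇ-sym : ∀ m n → (m ≡ᵇ n) ≡ (n ≡ᵇ m)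
    ≡ᵇ-sym zero    zero    = refl
    ≡ᵇ-sym zero    (suc n) = refl
    ≡ᵇ-sym (suc m) zero    = refl
    ≡ᵇ-sym (suc m) (suc n) = ≡ᵇ-sym m n
slackWalk≡dualWalk₀ (N ∷ w) h h' = slackWalk≡dualWalk₀ w (suc h) h'
slackWalk≡dualWalk₀ (E ∷ w) h h' = lower-cong 1 h (λ h₁ → slackWalk≡dualWalk₀ w h₁ h')
slackWalk≡dualWalk₀ (D ∷ w) h h' = slackWalk≡dualWalk₀ w h h'

LittlePath : ℕ → Set
LittlePath j = Σ (List Step) (T ∘ isLittleSchroeder j)

little⇒ : ∀ j w → T (isLittleSchroeder j w) →
  T (S₀.dualWalk 0 w 0) × (Δx w ≡ j × Δy w ≡ j) × T (noDiagD (0 , 0) w)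
little⇒ j w t =
  subst T (slackWalk≡dualWalk₀ w 0 0) (S₀.⇒slackWalk w 0 0 stays (trans Δy≡ (sym (trans (*-identityˡ (Δx w)) Δx≡)))) ,
  (Δx≡ , Δy≡) , ∧-snd (aboveSlope 1 (0 , 0) w) rest
  where
    rest = ∧-snd (eqPt (endpoint (0 , 0) w) (j , j)) t
    ends : (Δx w , Δy w) ≡ (j , j)
    ends = trans (sym (endpoint-Δ 0 0 w)) (eqPt⇒≡ _ _ (∧-fst (eqPt (endpoint (0 , 0) w) (j , j)) t))
    Δx≡ = cong proj₁ ends
    Δy≡ = cong proj₂ ends
    stays : T (S₀.slackStays 0 w)
    stays = subst T (S₀.aboveSlope≡slackStays w 0 0 0 refl) (∧-fst (aboveSlope 1 (0 , 0) w) rest)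

⇒little : ∀ j w → T (S₀.dualWalk 0 w 0) → Δx w ≡ j → T (noDiagD (0 , 0) w) → T (isLittleSchroeder j w)
⇒little j w walk Δx≡ noD =
  ∧-intro (≡⇒eqPt _ _ (trans (endpoint-Δ 0 0 w) (cong₂ _,_ Δx≡ (trans Δy≡ Δx≡))))
          (∧-intro (subst T (sym (S₀.aboveSlope≡slackStays w 0 0 0 refl)) (proj₁ balance)) noD)
  where
    balance = S₀.slackWalk⇒ w 0 0 (subst T (sym (slackWalk≡dualWalk₀ w 0 0)) walk)
    Δy≡ : Δy w ≡ Δx w
    Δy≡ = trans (proj₂ balance) (*-identityˡ (Δx w))

archTokens : List (List Prime) → List Token
archTokens ls = map (prime ∘ arch) ls

arches : List Token → List (List Prime)
arches []                    = []
arches (prime (arch L) ∷ ts) = L ∷ arches ts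
arches (prime diag ∷ ts)     = arches ts
arches (east ∷ ts)           = arches ts

arches-archTokens : ∀ ls → arches (archTokens ls) ≡ ls
arches-archTokens []       = refl
arches-archTokens (L ∷ ls) = cong (L ∷_) (arches-archTokens ls)

Δx-archTokens : ∀ ls → Δx (tokensPath (archTokens ls)) ≡ archesSize ls
Δx-archTokens []       = refl
Δx-archTokens (L ∷ ls) =
  trans (Δx-++ (primePath (arch L)) (tokensPath (archTokens ls))) (cong₂ _+_ (Δx-primePath (arch L)) (Δx-archTokens ls))

tokensSize-archTokens : ∀ ls → tokensSize (archTokens ls) ≡ archesSize ls
tokensSize-archTokens []       = refl
tokensSize-archTokens (L ∷ ls) = cong (suc (forestSize L) +_) (tokensSize-archTokens ls)

shapeWalk-archTokens : ∀ ls → T (F₀.shapeWalk 0 (shape (archTokens ls)) 0)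
shapeWalk-archTokens []       = tt
shapeWalk-archTokens (L ∷ ls) = shapeWalk-archTokens ls

-- No D-step on the diagonal: primes starting strictly above the diagonal
-- and arches starting on it have none.
noDiagD-++ : ∀ p w v → noDiagD p (w ++ v) ≡ noDiagD p w ∧ noDiagD (endpoint p w) v
noDiagD-++ p       []      v = refl
noDiagD-++ (x , y) (E ∷ w) v = noDiagD-++ (suc x , y) w v
noDiagD-++ (x , y) (N ∷ w) v = noDiagD-++ (x , suc y) w v
noDiagD-++ (x , y) (D ∷ w) v = trans (cong (not (x ≡ᵇ y) ∧_) (noDiagD-++ (suc x , suc y) w v))
                                     (sym (∧-assoc (not (x ≡ᵇ y)) _ _))

endpoint-primePath : ∀ x y p → endpoint (x , y) (primePath p) ≡ (x + suc (primeSize p) , y + suc (primeSize p))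
endpoint-primePath x y p =
  trans (endpoint-Δ x y (primePath p)) (cong₂ (λ s t → x + s , y + t) (Δx-primePath p) (Δy-primePath p))

private
  off-diagonal : ∀ x y → x < y → T (not (x ≡ᵇ y))
  off-diagonal x y lt with x ≡ᵇ y in eq
  ... | true  = ⊥-elim (<⇒≢ lt (≡ᵇ⇒≡ x y (subst T (sym eq) tt)))
  ... | false = tt

mutual
  noDiagD-prime : ∀ p x y → x < y → T (noDiagD (x , y) (primePath p))
  noDiagD-prime diag     x y lt = ∧-intro (off-diagonal x y lt) tt
  noDiagD-prime (arch L) x y lt = noDiagD-arch L x y (<⇒≤ lt)

  noDiagD-arch : ∀ L x y → x ≤ y → T (noDiagD (x , y) (primePath (arch L)))
  noDiagD-arch L x y le = subst T (sym (noDiagD-++ (x , suc y) (forestPath L) (E ∷ [])))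
    (∧-intro (noDiagD-forest L x (suc y) (s≤s le)) (lastE (endpoint (x , suc y) (forestPath L))))
    where
      lastE : ∀ q → T (noDiagD q (E ∷ []))
      lastE (x , y) = tt

  noDiagD-forest : ∀ L x y → x < y → T (noDiagD (x , y) (forestPath L))
  noDiagD-forest []      x y lt = tt
  noDiagD-forest (p ∷ L) x y lt = subst T (sym (noDiagD-++ (x , y) (primePath p) (forestPath L)))
    (∧-intro (noDiagD-prime p x y lt) (subst (λ q → T (noDiagD q (forestPath L))) (sym (endpoint-primePath x y p))
      (noDiagD-forest L (x + suc (primeSize p)) (y + suc (primeSize p)) (+-monoˡ-< (suc (primeSize p)) lt))))

noDiagD-archTokens : ∀ ls x → T (noDiagD (x , x) (tokensPath (archTokens ls)))
noDiagD-archTokens []       x = tt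
noDiagD-archTokens (L ∷ ls) x = subst T (sym (noDiagD-++ (x , x) (primePath (arch L)) (tokensPath (archTokens ls))))
  (∧-intro (noDiagD-arch L x x ≤-refl)
    (subst (λ q → T (noDiagD q (tokensPath (archTokens ls)))) (sym (endpoint-primePath x x (arch L)))
      (noDiagD-archTokens ls (x + suc (forestSize L)))))

archTokens-arches : ∀ ts x → T (F₀.shapeWalk 0 (shape ts) 0) → T (noDiagD (x , x) (tokensPath ts)) →
  archTokens (arches ts) ≡ ts
archTokens-arches []                    x walk noD = refl
archTokens-arches (prime diag ∷ ts)     x walk noD =
  ⊥-elim (subst T (cong not (T⇒≡true (≡⇒≡ᵇ x x refl))) (∧-fst (not (x ≡ᵇ x)) noD))
archTokens-arches (prime (arch L) ∷ ts) x walk noD =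
  cong (prime (arch L) ∷_) (archTokens-arches ts (x + suc (forestSize L)) walk
    (subst (λ q → T (noDiagD q (tokensPath ts))) (endpoint-primePath x x (arch L))
      (∧-snd (noDiagD (x , x) (primePath (arch L)))
        (subst T (noDiagD-++ (x , x) (primePath (arch L)) (tokensPath ts)) noD))))

tokensPath-arches : ∀ j w → T (isLittleSchroeder j w) → tokensPath (archTokens (arches (parse w))) ≡ w
tokensPath-arches j w t = trans (cong tokensPath onlyArches) flat
  where
    conditions = little⇒ j w t
    flat : tokensPath (parse w) ≡ w
    flat = F₀.tokensPath-parse w 0 (proj₁ conditions)
    onlyArches : archTokens (arches (parse w)) ≡ parse w
    onlyArches = archTokens-arches (parse w) 0
      (subst T (F₀.dualWalk-tokensPath (parse w) 0 0)
        (subst (λ z → T (S₀.dualWalk 0 z 0)) (sym flat) (proj₁ conditions)))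
      (subst (λ z → T (noDiagD (0 , 0) z)) (sym flat) (proj₂ (proj₂ conditions)))

arches↔littlePaths : ∀ j → Arches j ↔ LittlePath j
arches↔littlePaths j = subset-↔ (λ _ → ≡-irrelevant) (λ _ → T-irrelevant)
  (tokensPath ∘ archTokens) (arches ∘ parse)
  (λ ls e → ⇒little j (tokensPath (archTokens ls))
     (subst T (sym (F₀.dualWalk-tokensPath (archTokens ls) 0 0)) (shapeWalk-archTokens ls))
     (trans (Δx-archTokens ls) e) (noDiagD-archTokens ls 0))
  (λ w t → begin
     archesSize (arches (parse w))                          ≡⟨ sym (tokensSize-archTokens (arches (parse w))) ⟩
     tokensSize (archTokens (arches (parse w)))             ≡⟨ sym (Δy-tokensPath (archTokens (arches (parse w)))) ⟩
     Δy (tokensPath (archTokens (arches (parse w))))        ≡⟨ cong Δy (tokensPath-arches j w t) ⟩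
     Δy w                                                   ≡⟨ proj₂ (proj₁ (proj₂ (little⇒ j w t))) ⟩
     j                                                      ∎)
  (λ ls _ → trans (cong arches (parse-tokensPath (archTokens ls))) (arches-archTokens ls))
  (tokensPath-arches j)
  where open ≡-Reasoning

private
  ΣFin-suc : ∀ {n} {F : Fin (suc n) → Set} → Σ (Fin (suc n)) F ↔ (F zero ⊎ Σ (Fin n) (F ∘ suc))
  ΣFin-suc = mk↔ₛ′ (λ { (zero , p) → inj₁ p ; (suc i , p) → inj₂ (i , p) })
                   (λ { (inj₁ p) → zero , p ; (inj₂ (i , p)) → suc i , p })
                   (λ { (inj₁ p) → refl ; (inj₂ (i , p)) → refl })
                   (λ { (zero , p) → refl ; (suc i , p) → refl })

  ΣFin-zero : ∀ {F G : Fin 0 → Set} → Σ (Fin 0) F ↔ Σ (Fin 0) G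
  ΣFin-zero = mk↔ₛ′ (λ { (() , _) }) (λ { (() , _) }) (λ { (() , _) }) (λ { (() , _) })

  Fin-zero : ∀ {G : Fin 0 → Set} → Fin 0 ↔ Σ (Fin 0) G
  Fin-zero = mk↔ₛ′ (λ ()) (λ { (() , _) }) (λ { (() , _) }) (λ ())

  Fin-suc : ∀ {n} → Fin (suc n) ↔ (⊤ ⊎ Fin n)
  Fin-suc = mk↔ₛ′ (λ { zero → inj₁ tt ; (suc i) → inj₂ i }) (λ { (inj₁ _) → zero ; (inj₂ i) → suc i })
                  (λ { (inj₁ tt) → refl ; (inj₂ i) → refl }) (λ { zero → refl ; (suc i) → refl })

  ⊥⊎-↔ : ∀ {X : Set} → X ↔ (⊥ ⊎ X)
  ⊥⊎-↔ = mk↔ₛ′ inj₂ (λ { (inj₁ ()) ; (inj₂ x) → x }) (λ { (inj₁ ()) ; (inj₂ x) → refl }) (λ _ → refl)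

  ΣStep↔ : ∀ {Q : Step → Set} → Σ Step Q ↔ (Q E ⊎ (Q N ⊎ Q D))
  ΣStep↔ = mk↔ₛ′ (λ { (E , q) → inj₁ q ; (N , q) → inj₂ (inj₁ q) ; (D , q) → inj₂ (inj₂ q) })
                 (λ { (inj₁ q) → E , q ; (inj₂ (inj₁ q)) → N , q ; (inj₂ (inj₂ q)) → D , q })
                 (λ { (inj₁ q) → refl ; (inj₂ (inj₁ q)) → refl ; (inj₂ (inj₂ q)) → refl })
                 (λ { (E , q) → refl ; (N , q) → refl ; (D , q) → refl })

Fin-sum↔ : ∀ K (g h : ℕ → ℕ) → Fin (sum (map g (applyUpTo h K))) ↔ Σ (Fin K) (λ i → Fin (g (h (toℕ i))))
Fin-sum↔ zero    g h = Fin-zero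
Fin-sum↔ (suc K) g h = ↔-trans +↔⊎ (↔-trans (↔-refl ⊎-↔ Fin-sum↔ K g (h ∘ suc)) (↔-sym ΣFin-suc))

Fin-filter↔ : ∀ {A : Set} (P : A → Bool) xs →
  Fin (length (filter (λ x → T? (P x)) xs)) ↔ Σ (Fin (length xs)) (λ i → T (P (lookup xs i)))
Fin-filter↔ P []       = Fin-zero
Fin-filter↔ P (x ∷ xs) with P x in eq
... | true  = ↔-trans Fin-suc (↔-trans (≡-↔ T (sym eq) ⊎-↔ Fin-filter↔ P xs) (↔-sym ΣFin-suc))
... | false = ↔-trans (Fin-filter↔ P xs)
                (↔-trans ⊥⊎-↔ (↔-trans (≡-↔ T (sym eq) ⊎-↔ ↔-refl) (↔-sym ΣFin-suc)))

private
  extensions : List Step → List (List Step)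
  extensions w = (E ∷ w) ∷ (N ∷ w) ∷ (D ∷ w) ∷ []

  positions-extensions : ∀ L (Q : List Step → Set) →
    Σ (Fin (length (concatMap extensions L))) (λ i → Q (lookup (concatMap extensions L) i)) ↔
    Σ (Fin (length L)) (λ i → Σ Step (λ s → Q (s ∷ lookup L i)))
  positions-extensions []      Q = ΣFin-zero
  positions-extensions (x ∷ L) Q =
    ↔-trans ΣFin-suc (↔-trans (↔-refl ⊎-↔ ΣFin-suc) (↔-trans (↔-refl ⊎-↔ (↔-refl ⊎-↔ ΣFin-suc))
      (↔-trans regroup (↔-trans (↔-sym ΣStep↔ ⊎-↔ positions-extensions L Q) (↔-sym ΣFin-suc)))))
    where
      regroup : ∀ {A B C R : Set} → (A ⊎ (B ⊎ (C ⊎ R))) ↔ ((A ⊎ (B ⊎ C)) ⊎ R)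
      regroup = ↔-trans (↔-refl ⊎-↔ ↔-sym (⊎-assoc 0ℓ _ _ _)) (↔-sym (⊎-assoc 0ℓ _ _ _))

positions-words : ∀ k (Q : List Step → Set) →
  Σ (Fin (length (words k))) (λ i → Q (lookup (words k) i)) ↔ Σ (List Step) (λ w → length w ≡ k × Q w)
positions-words zero    Q = mk↔ₛ′ (λ { (zero , q) → [] , refl , q }) (λ { ([] , refl , q) → zero , q })
                                  (λ { ([] , refl , q) → refl }) (λ { (zero , q) → refl })
positions-words (suc k) Q =
  ↔-trans (positions-extensions (words k) Q) (↔-trans (positions-words k (λ w → Σ Step (λ s → Q (s ∷ w))))
    (mk↔ₛ′ (λ (w , e , s , q) → s ∷ w , cong suc e , q)
           (λ { ([] , () , _) ; (s ∷ w , e , q) → w , suc-injective e , s , q })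
           (λ { ([] , () , _) ; (s ∷ w , e , q) → cong (λ z → s ∷ w , z , q) (≡-irrelevant _ _) })
           (λ (w , e , s , q) → cong (λ z → w , z , s , q) (≡-irrelevant _ _))))

group-by-length↔ : ∀ {K} (P : List Step → Set) → (∀ w → P w → length w < K) →
  Σ (Fin K) (λ i → Σ (List Step) (λ w → length w ≡ toℕ i × P w)) ↔ Σ (List Step) P
group-by-length↔ {K} P bound = mk↔ₛ′ (λ (_ , w , _ , p) → w , p)
  (λ (w , p) → fromℕ< (bound w p) , w , sym (toℕ-fromℕ< (bound w p)) , p)
  (λ _ → refl)
  (λ (i , w , e , p) → same-length (toℕ-injective (trans (toℕ-fromℕ< (bound w p)) e)) w _ e p)
  where
    same-length : ∀ {i i'} (q : i ≡ i') w (e : length w ≡ toℕ i) (e' : length w ≡ toℕ i') p →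
      _≡_ {A = Σ (Fin K) (λ i → Σ (List Step) (λ w → length w ≡ toℕ i × P w))} (i , w , e , p) (i' , w , e' , p)
    same-length {i} refl w e e' p = cong (λ z → i , w , z , p) (≡-irrelevant e e')

length≤Δx+Δy : ∀ w → length w ≤ Δx w + Δy w
length≤Δx+Δy []      = z≤n
length≤Δx+Δy (E ∷ w) = s≤s (length≤Δx+Δy w)
length≤Δx+Δy (N ∷ w) = subst (suc (length w) ≤_) (sym (+-suc (Δx w) (Δy w))) (s≤s (length≤Δx+Δy w))
length≤Δx+Δy (D ∷ w) = s≤s (≤-trans (length≤Δx+Δy w) (≤-trans (n≤1+n _) (≤-reflexive (sym (+-suc (Δx w) (Δy w))))))

littlePaths↔Fin : ∀ m → LittlePath m ↔ Fin (littleSchroeder m)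
littlePaths↔Fin m = ↔-sym (↔-trans (Fin-sum↔ (suc (2 * m)) _ id)
  (↔-trans (Σ-↔ ↔-refl (λ {i} → Fin-filter↔ (isLittleSchroeder m) (words (toℕ i))))
    (↔-trans (Σ-↔ ↔-refl (λ {i} → positions-words (toℕ i) (T ∘ isLittleSchroeder m)))
      (group-by-length↔ (T ∘ isLittleSchroeder m) bound))))
  where
    bound : ∀ w → T (isLittleSchroeder m w) → length w < suc (2 * m)
    bound w t with little⇒ m w t
    ... | _ , (Δx≡ , Δy≡) , _ = s≤s (subst (length w ≤_)
          (trans (cong₂ _+_ Δx≡ Δy≡) (cong (m +_) (sym (+-identityʳ m)))) (length≤Δx+Δy w))

primes↔σ : ∀ j → PrimeOfSize j ↔ Fin (σ (suc j))
primes↔σ j = ↔-trans (primes↔2×arches j)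
  (↔-trans (↔-refl ×-↔ ↔-trans (arches↔littlePaths j) (littlePaths↔Fin j))
           (↔-sym (*↔× {2} {littleSchroeder j})))

Σ-swap : ∀ {A : Set} {B C : A → Set} → Σ (Σ A B) (C ∘ proj₁) ↔ Σ (Σ A C) (B ∘ proj₁)
Σ-swap = mk↔ₛ′ (λ ((x , b) , c) → (x , c) , b) (λ ((x , c) , b) → (x , b) , c) (λ _ → refl) (λ _ → refl)

-- Schröder paths of slope α = a + 1 are valid shapes whose rises j are
-- coloured by σ (j + 1) colours, and so are the coloured Dyck paths.
schroeder↔colouredShapes : ∀ a n → SchroederPath (suc a) n ↔
  Σ (Σ (List Letter) (Factorisation.ValidShape a n)) (λ (vs , _) → All (Fin ∘ σ ∘ suc) (riseSizes vs))
schroeder↔colouredShapes a n =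
  ↔-trans (Slack.schroeder↔dual a n)
    (↔-trans (Factorisation.dual↔tokens a n)
      (↔-trans (Factorisation.tokens↔shapes a n)
        (↔-trans Σ-swap (Σ-↔ ↔-refl (λ {(vs , _)} → All-↔ primes↔σ (riseSizes vs))))))

-- α ≥ 1 only excludes α = 0.
theorem3p1 : (α n : ℕ) → 1 ≤ α → 1 ≤ n →
    SchroederPath α n ↔ ColoredDyck (α ∸ 1) σ n
theorem3p1 (suc a) n _ _ =
  ↔-trans (schroeder↔colouredShapes a n) (↔-sym (DyckShapes.colouredDyck↔colouredShapes a n))
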